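{- Consider the $(1+\varepsilon)$-adversarial sampling process with $0<\varepsilon<1/2$ on $k$ elements, with starting weights normalized so that $\frac1k\sum_{e\in E_0}w_0(e)=1$, and with any adversary. Let $\ell_{max}$ be the largest $\ell\in\{1,2,\dots,\lfloor|S_0|/2\rfloor\}$ that is bad, if such an $\ell$ exists, and $\ell_{max}=1$ otherwise. Then for every $i\in\{0,1,\dots,k-1\}$ we have $$\frac{w_i(E_i)}{k-i}\le 90\,\ell_{max}.$$
   Context: The $(1+\varepsilon)$-adversarial sampling process: initially there is a set $E_0$ of $k$ elements with nonnegative weights $w_0(e)$. In round $i$ ($i=0,1,\dots,k-1$): let $D_i$ be the distribution on $E_i$ giving $e$ probability $w_i(e)/\sum_{e'\in E_i}w_i(e')$; an adversary chooses a distribution $D_i^\varepsilon$ on $E_i$ with $(1-\varepsilon)\Pr_{D_i}(e)\le\Pr_{D_i^\varepsilon}(e)\le(1+\varepsilon)\Pr_{D_i}(e)$ for all $e$; $e_{i+1}$ is sampled from $D_i^\varepsilon$ and $E_{i+1}=E_i\setminus\{e_{i+1}\}$; then an adversary chooses weights $w_{i+1}(e)$, $e\in E_{i+1}$, with $0\le w_{i+1}(e)\le w_i(e)$. Adversary choices may depend on the history. Notation: for $E\subseteq E_i$, $w_i(E)=\sum_{e\in E}w_i(e)$. For each $i$, partition $E_i=B_i\sqcup M_i\sqcup S_i$ where $e\in B_i$ iff $w_i(e)\ge 80$, $e\in M_i$ iff $2<w_i(e)<80$, and $e\in S_i$ iff $w_i(e)\le 2$. For $\ell\in\{1,\dots,|S_0|\}$,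 $i_\ell$ is the smallest $i$ with $|S_i|=\ell$. An $\ell\in\{1,\dots,\lfloor|S_0|/2\rfloor\}$ is called bad if both $w_{i_{2\ell}}(B_{i_{2\ell}})\le 8\ell$ and $w_{i_\ell}(B_{i_\ell})>4\ell$; otherwise it is good.
   Formalization: The weights $w_i(e)$, the parameter $\varepsilon$ and the probabilities given by each adversarial distribution $D_i^\varepsilon$ take only rational values. -}

module Defs where

open import Data.Nat as ℕ using (ℕ; zero; suc; _∸_)
open import Data.Nat.Properties using (_<?_)
open import Data.Nat.DivMod using (_/_)
open import Data.Integer using (+_)
open import Data.Fin as Fin using (Fin; toℕ; fromℕ<)
open import Data.List using (List; filter; foldr; length; allFin)
open import Data.Bool.ListAction using (any)
open import Data.Bool using (Bool; not; true; false; _∧_; T)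
open import Data.Product using (Σ; ∃; ∃₂; _×_; _,_)
open import Data.Sum using (_⊎_)
open import Relation.Nullary using (¬_; does)
open import Relation.Nullary.Decidable using (T?)
open import Relation.Binary.PropositionalEquality using (_≡_; _≢_)
open import Function.Definitions using (Injective)
open import Data.Rational as ℚ using (ℚ; 0ℚ; 1ℚ; ½)
open import Data.Rational.Properties using (_≤?_)

⟦_⟧ : ℕ → ℚ
⟦ n ⟧ = ℚ._/_ (+ n) 1

sumL : {A : Set} → (A → ℚ) → List A → ℚ
sumL f = foldr (λ a s → f a ℚ.+ s) 0ℚ

-- One run (sample path) of the process on the ground set E_0 = Fin k:
--   σ j     = e_{j+1}, the element sampled in round j (σ is the removal order),
--   w i e   = w_i(e)           (only meaningful for e ∈ E_i),
--   p i e   = Pr_{D_i^ε}(e)     (only meaningful for e ∈ E_i).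
module Process (k : ℕ) (σ : Fin k → Fin k) (w : ℕ → Fin k → ℚ) where

  removed? : ℕ → Fin k → Bool
  removed? i e = any (λ j → does (toℕ j <? i) ∧ does (σ j Fin.≟ e)) (allFin k)

  InE : ℕ → Fin k → Set
  InE i e = T (not (removed? i e))

  E : ℕ → List (Fin k)
  E i = filter (λ e → T? (not (removed? i e))) (allFin k)

  W : ℕ → ℚ
  W i = sumL (w i) (E i)

  B : ℕ → List (Fin k)
  B i = filter (λ e → ⟦ 80 ⟧ ≤? w i e) (E i)

  S : ℕ → List (Fin k)
  S i = filter (λ e → w i e ≤? ⟦ 2 ⟧) (E i)

  IsFirst : ℕ → ℕ → Set
  IsFirst ℓ i = i ℕ.≤ k × length (S i) ≡ ℓ × (∀ j → j ℕ.< i → length (S j) ≢ ℓ)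

  Bad : ℕ → Set
  Bad ℓ = 1 ℕ.≤ ℓ × ℓ ℕ.≤ length (S 0) / 2 ×
          ∃₂ λ i₁ i₂ → IsFirst ℓ i₁ × IsFirst (2 ℕ.* ℓ) i₂ ×
                       sumL (w i₂) (B i₂) ℚ.≤ ⟦ 8 ℕ.* ℓ ⟧ ×
                       ⟦ 4 ℕ.* ℓ ⟧ ℚ.< sumL (w i₁) (B i₁)

  IsLmax : ℕ → Set
  IsLmax L = (Bad L × (∀ ℓ → Bad ℓ → ℓ ℕ.≤ L)) ⊎ (L ≡ 1 × (∀ ℓ → ¬ Bad ℓ))

  -- p i is an admissible adversarial distribution D_i^ε on E_i (when w_i(E_i) > 0):
  -- it sums to 1 and (1-ε)·w_i(e)/w_i(E_i) ≤ p i e ≤ (1+ε)·w_i(e)/w_i(E_i)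
  -- (multiplied through by w_i(E_i) > 0).
  AdmissibleDist : ℚ → ℕ → (Fin k → ℚ) → Set
  AdmissibleDist ε i q =
    sumL q (E i) ≡ 1ℚ ×
    (∀ e → InE i e → ((1ℚ ℚ.- ε) ℚ.* w i e ℚ.≤ q e ℚ.* W i) ×
                     (q e ℚ.* W i ℚ.≤ (1ℚ ℚ.+ ε) ℚ.* w i e))

  record ValidRun (ε : ℚ) (p : ℕ → Fin k → ℚ) : Set where
    field
      σ-injective  : Injective _≡_ _≡_ σ
      w₀-nonneg    : ∀ e → 0ℚ ℚ.≤ w 0 e
      normalised   : W 0 ≡ ⟦ k ⟧
      reweight     : ∀ i → i ℕ.< k → ∀ e → InE (suc i) e →
                       (0ℚ ℚ.≤ w (suc i) e) × (w (suc i) e ℚ.≤ w i e)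
      adversary    : ∀ i → i ℕ.< k → 0ℚ ℚ.< W i → AdmissibleDist ε i (p i)
      sampled      : ∀ i → (i<k : i ℕ.< k) → 0ℚ ℚ.< W i → 0ℚ ℚ.< p i (σ (fromℕ< i<k))

{-# OPTIONS --safe #-}
-- Write s i = |S_i| and b i = w_i(B_i). Weights only decrease, so b is non-increasing and
-- s drops by at most one per round; moreover b 0 ≤ w_0(E_0) = k, and k ≤ 2 s 0 because every
-- element outside S_0 weighs more than 2. Call m good if b i ≤ 4m whenever s i ≤ m. Every m with
-- s 0 < 2m is good, as b i ≤ k ≤ 2 s 0 < 4m. If ℓ_max < m, 2m ≤ s 0 and 2m is good, then so is m:
-- otherwise b exceeds 4m at i_m, the first round with s ≤ m, while it is at most 8m at i_{2m},
-- so m is bad. Hence every m > ℓ_max is good, and m = max(ℓ_max + 1, s i) ≤ 2 ℓ_max (k - i) gives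
-- w_i(E_i) ≤ 80 |E_i| + b i ≤ 80 (k - i) + 8 ℓ_max (k - i) ≤ 90 ℓ_max (k - i).
module Submission where

open import Defs
open import Data.Bool using (Bool; T; not; true; false; _∧_)
open import Data.Bool.Properties using (T-not-≡)
open import Data.Fin as Fin using (Fin; toℕ; fromℕ<)
import Data.Fin.Properties as Finₚ
open import Data.Integer as ℤ using (+_)
import Data.Integer.Properties as ℤₚ
open import Data.List using (List; []; _∷_; filter; length; allFin)
import Data.List.Properties as Listₚ
open import Data.List.Membership.Propositional using (_∈_; lose)
open import Data.List.Membership.Propositional.Properties using (∈-allFin)
open import Data.List.Relation.Unary.All as All using (All; []; _∷_)
open import Data.List.Relation.Unary.Any using (here; there; satisfied)
open import Data.List.Relation.Unary.Any.Properties using (any⁺; any⁻)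
open import Data.List.Relation.Unary.Unique.Propositional using (Unique; []; _∷_)
open import Data.List.Relation.Unary.Unique.Propositional.Properties using (allFin⁺)
open import Data.Nat as ℕ using (ℕ; zero; suc; _∸_; z≤n; s≤s; z<s)
open import Data.Nat.Divisibility using (∣1⇒≡1)
import Data.Nat.DivMod as DivMod
open DivMod using (_/_)
import Data.Nat.Properties as ℕₚ
import Data.Nat.Solver as ℕSolver
open import Data.Product using (∃; _×_; _,_; proj₁; proj₂; uncurry)
open import Data.Rational as ℚ using (ℚ; 0ℚ; ½; mkℚ; *≤*)
import Data.Rational.Properties as ℚₚ
open import Data.Rational.Solver using (module +-*-Solver)
import Data.Rational.Unnormalised as ℚᵘ
import Data.Rational.Unnormalised.Properties as ℚᵘₚ
open import Data.Sum using (inj₁; inj₂)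
open import Function using (const; case_of_; _∘_)
open import Function.Bundles using (Equivalence; _⇔_; mk⇔)
open import Relation.Binary.PropositionalEquality
open import Relation.Nullary using (¬_; yes; no; does; contradiction; ofʸ; ofⁿ)
open import Relation.Nullary.Decidable using (T?)
open import Relation.Unary using (Pred; Decidable)
open import Relation.Unary.Properties using (_∩?_)

⟦⟧≡mkℚ : ∀ n → ⟦ n ⟧ ≡ mkℚ (+ n) 0 (λ (_ , d∣1) → ∣1⇒≡1 d∣1)
⟦⟧≡mkℚ n = ℚₚ.normalize-coprime _

⟦⟧-mono-≤ : ∀ {m n} → m ℕ.≤ n → ⟦ m ⟧ ℚ.≤ ⟦ n ⟧
⟦⟧-mono-≤ {m} {n} m≤n rewrite ⟦⟧≡mkℚ m | ⟦⟧≡mkℚ n =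
  *≤* (subst₂ ℤ._≤_ (sym (ℤₚ.*-identityʳ (+ m))) (sym (ℤₚ.*-identityʳ (+ n))) (ℤ.+≤+ m≤n))

⟦⟧-cancel-≤ : ∀ {m n} → ⟦ m ⟧ ℚ.≤ ⟦ n ⟧ → m ℕ.≤ n
⟦⟧-cancel-≤ {m} {n} m≤n rewrite ⟦⟧≡mkℚ m | ⟦⟧≡mkℚ n with m≤n
... | *≤* m*1≤n*1 rewrite ℤₚ.*-identityʳ (+ m) | ℤₚ.*-identityʳ (+ n) = ℤₚ.drop‿+≤+ m*1≤n*1

⟦⟧-+ : ∀ m n → ⟦ m ℕ.+ n ⟧ ≡ ⟦ m ⟧ ℚ.+ ⟦ n ⟧
⟦⟧-+ m n = ℚₚ.toℚᵘ-injective (ℚᵘₚ.≃-trans unnormalised (ℚᵘₚ.≃-sym (ℚₚ.toℚᵘ-homo-+ ⟦ m ⟧ ⟦ n ⟧)))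
  where
  unnormalised : ℚ.toℚᵘ ⟦ m ℕ.+ n ⟧ ℚᵘ.≃ ℚ.toℚᵘ ⟦ m ⟧ ℚᵘ.+ ℚ.toℚᵘ ⟦ n ⟧
  unnormalised rewrite ⟦⟧≡mkℚ m | ⟦⟧≡mkℚ n | ⟦⟧≡mkℚ (m ℕ.+ n) = ℚᵘ.*≡* (begin
    + (m ℕ.+ n) ℤ.* + 1               ≡⟨ ℤₚ.*-identityʳ _ ⟩
    + m ℤ.+ + n                        ≡⟨ sym (cong₂ ℤ._+_ (ℤₚ.*-identityʳ (+ m)) (ℤₚ.*-identityʳ (+ n))) ⟩
    + m ℤ.* + 1 ℤ.+ + n ℤ.* + 1        ≡⟨ sym (ℤₚ.*-identityʳ _) ⟩
    (+ m ℤ.* + 1 ℤ.+ + n ℤ.* + 1) ℤ.* + 1 ∎)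
    where open ≡-Reasoning

⟦⟧-* : ∀ m n → ⟦ m ℕ.* n ⟧ ≡ ⟦ m ⟧ ℚ.* ⟦ n ⟧
⟦⟧-* m n = ℚₚ.toℚᵘ-injective (ℚᵘₚ.≃-trans unnormalised (ℚᵘₚ.≃-sym (ℚₚ.toℚᵘ-homo-* ⟦ m ⟧ ⟦ n ⟧)))
  where
  unnormalised : ℚ.toℚᵘ ⟦ m ℕ.* n ⟧ ℚᵘ.≃ ℚ.toℚᵘ ⟦ m ⟧ ℚᵘ.* ℚ.toℚᵘ ⟦ n ⟧
  unnormalised rewrite ⟦⟧≡mkℚ m | ⟦⟧≡mkℚ n | ⟦⟧≡mkℚ (m ℕ.* n) = ℚᵘ.*≡* (begin
    + (m ℕ.* n) ℤ.* + 1     ≡⟨ ℤₚ.*-identityʳ _ ⟩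
    + (m ℕ.* n)             ≡⟨ ℤₚ.pos-* m n ⟩
    + m ℤ.* + n             ≡⟨ sym (ℤₚ.*-identityʳ _) ⟩
    (+ m ℤ.* + n) ℤ.* + 1   ∎)
    where open ≡-Reasoning

0≤⟦⟧ : ∀ n → 0ℚ ℚ.≤ ⟦ n ⟧
0≤⟦⟧ n = ⟦⟧-mono-≤ {0} {n} z≤n

p≤q+p : ∀ {p q} → 0ℚ ℚ.≤ q → p ℚ.≤ q ℚ.+ p
p≤q+p {p} {q} 0≤q = subst (ℚ._≤ q ℚ.+ p) (ℚₚ.+-identityˡ p) (ℚₚ.+-monoˡ-≤ p 0≤q)

module _ {A : Set} where

  sumL-const : ∀ c (xs : List A) → sumL (λ _ → ⟦ c ⟧) xs ≡ ⟦ c ℕ.* length xs ⟧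
  sumL-const c []       = cong ⟦_⟧ (sym (ℕₚ.*-zeroʳ c))
  sumL-const c (x ∷ xs) = begin
    ⟦ c ⟧ ℚ.+ sumL (λ _ → ⟦ c ⟧) xs   ≡⟨ cong (⟦ c ⟧ ℚ.+_) (sumL-const c xs) ⟩
    ⟦ c ⟧ ℚ.+ ⟦ c ℕ.* length xs ⟧     ≡⟨ sym (⟦⟧-+ c _) ⟩
    ⟦ c ℕ.+ c ℕ.* length xs ⟧         ≡⟨ cong ⟦_⟧ (sym (ℕₚ.*-suc c (length xs))) ⟩
    ⟦ c ℕ.* suc (length xs) ⟧         ∎
    where open ≡-Reasoning

  module _ {p} {P : Pred A p} (P? : Decidable P) (f : A → ℚ) {c : ℚ} where
    open +-*-Solver

    sumL-≤-const+filter : 0ℚ ℚ.≤ c → (∀ a → ¬ P a → f a ℚ.≤ c) → ∀ xs →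
      sumL f xs ℚ.≤ sumL (const c) xs ℚ.+ sumL f (filter P? xs)
    sumL-≤-const+filter 0≤c small [] = ℚₚ.≤-refl
    sumL-≤-const+filter 0≤c small (x ∷ xs) with ih ← sumL-≤-const+filter 0≤c small xs | P? x
    ... | yes _ = begin
      f x ℚ.+ sumL f xs                        ≤⟨ ℚₚ.+-monoʳ-≤ (f x) ih ⟩
      f x ℚ.+ (C ℚ.+ F)                        ≤⟨ p≤q+p 0≤c ⟩
      c ℚ.+ (f x ℚ.+ (C ℚ.+ F))                ≡⟨ solve 4 (λ a b c d → c :+ (a :+ (b :+ d)) := (c :+ b) :+ (a :+ d)) refl (f x) C c F ⟩
      (c ℚ.+ C) ℚ.+ (f x ℚ.+ F)                ∎
      where
      open ℚₚ.≤-Reasoning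
      C F : ℚ
      C = sumL (const c) xs
      F = sumL f (filter P? xs)
    ... | no ¬Px = begin
      f x ℚ.+ sumL f xs                        ≤⟨ ℚₚ.+-mono-≤ (small x ¬Px) ih ⟩
      c ℚ.+ (C ℚ.+ F)                          ≡⟨ sym (ℚₚ.+-assoc c C F) ⟩
      (c ℚ.+ C) ℚ.+ F                          ∎
      where
      open ℚₚ.≤-Reasoning
      C F : ℚ
      C = sumL (const c) xs
      F = sumL f (filter P? xs)

    const≤sumL+filter : (∀ a → 0ℚ ℚ.≤ f a) → (∀ a → ¬ P a → c ℚ.≤ f a) → ∀ xs →
      sumL (const c) xs ℚ.≤ sumL f xs ℚ.+ sumL (const c) (filter P? xs)
    const≤sumL+filter f≥0 large [] = ℚₚ.≤-refl
    const≤sumL+filter f≥0 large (x ∷ xs) with ih ← const≤sumL+filter f≥0 large xs | P? x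
    ... | yes _ = begin
      c ℚ.+ C                                  ≤⟨ ℚₚ.+-monoʳ-≤ c ih ⟩
      c ℚ.+ (S ℚ.+ K)                          ≤⟨ p≤q+p (f≥0 x) ⟩
      f x ℚ.+ (c ℚ.+ (S ℚ.+ K))                ≡⟨ solve 4 (λ a b c d → a :+ (c :+ (b :+ d)) := (a :+ b) :+ (c :+ d)) refl (f x) S c K ⟩
      (f x ℚ.+ S) ℚ.+ (c ℚ.+ K)                ∎
      where
      open ℚₚ.≤-Reasoning
      C S K : ℚ
      C = sumL (const c) xs
      S = sumL f xs
      K = sumL (const c) (filter P? xs)
    ... | no ¬Px = begin
      c ℚ.+ C                                  ≤⟨ ℚₚ.+-mono-≤ (large x ¬Px) ih ⟩
      f x ℚ.+ (S ℚ.+ K)                        ≡⟨ sym (ℚₚ.+-assoc (f x) S K) ⟩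
      (f x ℚ.+ S) ℚ.+ K                        ∎
      where
      open ℚₚ.≤-Reasoning
      C S K : ℚ
      C = sumL (const c) xs
      S = sumL f xs
      K = sumL (const c) (filter P? xs)

module _ {A : Set} {p q} {P : Pred A p} {Q : Pred A q} (P? : Decidable P) (Q? : Decidable Q) where

  filter-filter : ∀ xs → filter P? (filter Q? xs) ≡ filter (Q? ∩? P?) xs
  filter-filter [] = refl
  filter-filter (x ∷ xs) with Q? x
  ... | no _  = filter-filter xs
  ... | yes _ with P? x
  ...   | yes _ = cong (x ∷_) (filter-filter xs)
  ...   | no _  = filter-filter xs

  sumL-filter-mono : ∀ {f g : A → ℚ} → (∀ a → P a → Q a) → (∀ a → P a → f a ℚ.≤ g a) →
    (∀ a → Q a → 0ℚ ℚ.≤ g a) → ∀ xs → sumL f (filter P? xs) ℚ.≤ sumL g (filter Q? xs)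
  sumL-filter-mono P⊆Q f≤g g≥0 [] = ℚₚ.≤-refl
  sumL-filter-mono P⊆Q f≤g g≥0 (x ∷ xs) with ih ← sumL-filter-mono P⊆Q f≤g g≥0 xs | P? x | Q? x
  ... | yes Px | yes _  = ℚₚ.+-mono-≤ (f≤g x Px) ih
  ... | yes Px | no ¬Qx = contradiction (P⊆Q x Px) ¬Qx
  ... | no _   | yes Qx = ℚₚ.≤-trans ih (p≤q+p (g≥0 x Qx))
  ... | no _   | no _   = ih

  length-filter-mono : ∀ {xs} → All (λ a → P a → Q a) xs → length (filter P? xs) ℕ.≤ length (filter Q? xs)
  length-filter-mono [] = z≤n
  length-filter-mono {x ∷ xs} (P⇒Q ∷ hs) with ih ← length-filter-mono hs | P? x | Q? x
  ... | yes Px | yes _  = s≤s ih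
  ... | yes Px | no ¬Qx = contradiction (P⇒Q Px) ¬Qx
  ... | no _   | yes _  = ℕₚ.m≤n⇒m≤1+n ih
  ... | no _   | no _   = ih

  length-filter-< : (∀ a → P a → Q a) → ∀ {x xs} → x ∈ xs → Q x → ¬ P x →
    length (filter P? xs) ℕ.< length (filter Q? xs)
  length-filter-< P⊆Q {xs = x ∷ xs} (here refl) Qx ¬Px with P? x | Q? x
  ... | yes Px | _      = contradiction Px ¬Px
  ... | no _   | no ¬Qx = contradiction Qx ¬Qx
  ... | no _   | yes _  = s≤s (length-filter-mono (All.universal P⊆Q xs))
  length-filter-< P⊆Q {xs = y ∷ xs} (there x∈xs) Qx ¬Px with ih ← length-filter-< P⊆Q x∈xs Qx ¬Px | P? y | Q? y
  ... | yes Py | yes _  = s≤s ih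
  ... | yes Py | no ¬Qy = contradiction (P⊆Q y Py) ¬Qy
  ... | no _   | yes _  = ℕₚ.m<n⇒m<1+n ih
  ... | no _   | no _   = ih

  -- When y ∈ P ∖ Q, the element y must be x, so on the tail P ⊆ Q by uniqueness.
  length-filter-≤-suc : ∀ {x xs} → Unique xs → (∀ a → P a → a ≢ x → Q a) →
    length (filter P? xs) ℕ.≤ suc (length (filter Q? xs))
  length-filter-≤-suc [] _ = z≤n
  length-filter-≤-suc {x} {y ∷ xs} (y∉xs ∷ u) P∖x⊆Q with ih ← length-filter-≤-suc u P∖x⊆Q | P? y | Q? y
  ... | yes Py | yes _  = s≤s ih
  ... | no _   | yes _  = ℕₚ.m≤n⇒m≤1+n ih
  ... | no _   | no _   = ih
  ... | yes Py | no ¬Qy = s≤s (length-filter-mono (All.map tail⊆Q y∉xs))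
    where
    tail⊆Q : ∀ {a} → y ≢ a → P a → Q a
    tail⊆Q y≢a Pa = P∖x⊆Q _ Pa λ a≡x → ¬Qy (P∖x⊆Q y Py λ y≡x → y≢a (trans y≡x (sym a≡x)))

antitone-from-step : ∀ {k} (f : ℕ → ℚ) → (∀ i → i ℕ.< k → f (suc i) ℚ.≤ f i) →
  ∀ {i j} → i ℕ.≤ j → j ℕ.≤ k → f j ℚ.≤ f i
antitone-from-step {k} f step i≤j = go (ℕₚ.≤⇒≤′ i≤j)
  where
  go : ∀ {i j} → i ℕ.≤′ j → j ℕ.≤ k → f j ℚ.≤ f i
  go ℕ.≤′-refl             _     = ℚₚ.≤-refl
  go (ℕ.≤′-step {j} i≤′j) 1+j≤k = ℚₚ.≤-trans (step j 1+j≤k) (go i≤′j (ℕₚ.<⇒≤ 1+j≤k))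

doubling-induction : ∀ {a} (G : ℕ → Set a) (L N : ℕ) →
  (∀ m → N ℕ.< 2 ℕ.* m → G m) →
  (∀ m → L ℕ.< m → 2 ℕ.* m ℕ.≤ N → G (2 ℕ.* m) → G m) →
  ∀ m → L ℕ.< m → G m
doubling-induction G L N large double m L<m = go N m L<m (ℕₚ.m<n+m N (positive L<m))
  where
  positive : ∀ {m} → L ℕ.< m → 0 ℕ.< m
  positive L<m = ℕₚ.≤-trans (s≤s z≤n) L<m

  go : ∀ n m → L ℕ.< m → N ℕ.< m ℕ.+ n → G m
  go n m L<m N<m+n with N ℕₚ.<? 2 ℕ.* m | n
  ... | yes N<2m | _     = large m N<2m
  ... | no N≮2m  | zero  = contradiction (ℕₚ.<-≤-trans N<m+n (ℕₚ.+-monoʳ-≤ m z≤n)) N≮2m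
  ... | no N≮2m  | suc n = double m L<m (ℕₚ.≮⇒≥ N≮2m) (go n (2 ℕ.* m) L<2m N<2m+n)
    where
    L<2m : L ℕ.< 2 ℕ.* m
    L<2m = ℕₚ.<-≤-trans L<m (ℕₚ.m≤m+n m _)
    N<2m+n : N ℕ.< 2 ℕ.* m ℕ.+ n
    N<2m+n = ℕₚ.<-≤-trans N<m+n (ℕₚ.≤-trans (ℕₚ.≤-reflexive (ℕₚ.+-suc m n))
               (ℕₚ.+-monoˡ-≤ n (ℕₚ.m<m+n m (ℕₚ.≤-trans (positive L<m) (ℕₚ.m≤m+n m 0)))))

module Run {k : ℕ} {σ : Fin k → Fin k} {w : ℕ → Fin k → ℚ} {ε : ℚ} {p : ℕ → Fin k → ℚ}
           (run : Process.ValidRun k σ w ε p) where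
  open Process k σ w
  open Process.ValidRun run

  removedAt : ℕ → Fin k → Fin k → Bool
  removedAt i e j = does (toℕ j ℕ.<? i) ∧ does (σ j Fin.≟ e)

  InE? : ∀ i → Decidable (InE i)
  InE? i e = T? (not (removed? i e))

  removedAt⇔ : ∀ {i e} j → T (removedAt i e j) ⇔ (toℕ j ℕ.< i × σ j ≡ e)
  -- does (toℕ j <? i) computes to toℕ j <ᵇ i, so we split on that boolean and its reflection.
  removedAt⇔ {i} {e} j with toℕ j ℕ.<ᵇ i | ℕₚ.<ᵇ-reflects-< (toℕ j) i | σ j Fin.≟ e
  ... | true  | ofʸ j<i | yes σj≡e = mk⇔ (const (j<i , σj≡e)) (const _)
  ... | true  | ofʸ _   | no σj≢e  = mk⇔ (λ ()) (σj≢e ∘ proj₂)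
  ... | false | ofⁿ j≮i | _        = mk⇔ (λ ()) (j≮i ∘ proj₁)

  InE-intro : ∀ {i e} → (∀ j → toℕ j ℕ.< i → σ j ≢ e) → InE i e
  InE-intro {i} {e} fresh with removed? i e in eq
  ... | false = _
  ... | true  =
    let j , removed-j = satisfied (any⁻ (removedAt i e) (allFin k) (subst T (sym eq) _))
    in uncurry (fresh j) (Equivalence.to (removedAt⇔ j) removed-j)

  InE-elim : ∀ {i e j} → InE i e → toℕ j ℕ.< i → σ j ≢ e
  InE-elim {i} {e} {j} inE j<i σj≡e = subst T (Equivalence.to T-not-≡ inE)
    (any⁺ (removedAt i e) (lose (∈-allFin j) (Equivalence.from (removedAt⇔ j) (j<i , σj≡e))))

  InE-zero : ∀ e → InE 0 e
  InE-zero e = InE-intro {0} {e} λ _ ()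

  InE-suc⇒InE : ∀ {i e} → InE (suc i) e → InE i e
  InE-suc⇒InE inE = InE-intro λ j j<i → InE-elim inE (ℕₚ.m<n⇒m<1+n j<i)

  module _ {i} (i<k : i ℕ.< k) where

    eᵢ₊₁ : Fin k
    eᵢ₊₁ = σ (fromℕ< i<k)

    InE-eᵢ₊₁ : InE i eᵢ₊₁
    InE-eᵢ₊₁ = InE-intro λ j j<i σj≡eᵢ₊₁ →
      ℕₚ.<-irrefl (trans (cong toℕ (σ-injective σj≡eᵢ₊₁)) (Finₚ.toℕ-fromℕ< i<k)) j<i

    ¬InE-suc-eᵢ₊₁ : ¬ InE (suc i) eᵢ₊₁
    ¬InE-suc-eᵢ₊₁ inE = InE-elim inE (s≤s (ℕₚ.≤-reflexive (Finₚ.toℕ-fromℕ< i<k))) refl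

    InE⇒InE-suc : ∀ {e} → InE i e → eᵢ₊₁ ≢ e → InE (suc i) e
    InE⇒InE-suc inE eᵢ₊₁≢e = InE-intro λ j j<1+i σj≡e → case ℕₚ.m<1+n⇒m<n∨m≡n j<1+i of λ where
      (inj₁ j<i) → InE-elim inE j<i σj≡e
      (inj₂ j≡i) → eᵢ₊₁≢e (trans (cong σ (Finₚ.toℕ-injective (trans (Finₚ.toℕ-fromℕ< i<k) (sym j≡i)))) σj≡e)

  Small? : ∀ i → Decidable (λ e → w i e ℚ.≤ ⟦ 2 ⟧)
  Small? i e = w i e ℚₚ.≤? ⟦ 2 ⟧

  Big? : ∀ i → Decidable (λ e → ⟦ 80 ⟧ ℚ.≤ w i e)
  Big? i e = ⟦ 80 ⟧ ℚₚ.≤? w i e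

  s : ℕ → ℕ
  s i = length (S i)

  b : ℕ → ℚ
  b i = sumL (w i) (B i)

  length-E₀ : length (E 0) ≡ k
  length-E₀ = trans (cong length (Listₚ.filter-all (InE? 0) (All.universal InE-zero (allFin k))))
                    (Listₚ.length-tabulate _)

  length-E : ∀ {i} → i ℕ.≤ k → length (E i) ℕ.≤ k ∸ i
  length-E {zero}  _     = ℕₚ.≤-reflexive length-E₀
  length-E {suc i} i<k = begin
    length (E (suc i))       ≤⟨ ℕₚ.<⇒≤pred (length-filter-< (InE? (suc i)) (InE? i) (λ _ → InE-suc⇒InE)
                                  (∈-allFin _) (InE-eᵢ₊₁ i<k) (¬InE-suc-eᵢ₊₁ i<k)) ⟩
    ℕ.pred (length (E i))    ≤⟨ ℕₚ.pred-mono-≤ (length-E (ℕₚ.<⇒≤ i<k)) ⟩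
    ℕ.pred (k ∸ i)           ≡⟨ ℕₚ.pred[m∸n]≡m∸[1+n] k i ⟩
    k ∸ suc i                ∎
    where open ℕₚ.≤-Reasoning

  s≤k∸i : ∀ {i} → i ℕ.≤ k → s i ℕ.≤ k ∸ i
  s≤k∸i {i} i≤k = ℕₚ.≤-trans (Listₚ.length-filter (Small? i) (E i)) (length-E i≤k)

  s-step : ∀ {i} → i ℕ.< k → s i ℕ.≤ suc (s (suc i))
  s-step {i} i<k = begin
    s i                                        ≡⟨ cong length (filter-filter (Small? i) (InE? i) (allFin k)) ⟩
    length (filter Sᵢ? (allFin k))             ≤⟨ length-filter-≤-suc Sᵢ? Sᵢ₊₁? (allFin⁺ k) stays ⟩
    suc (length (filter Sᵢ₊₁? (allFin k)))     ≡⟨ cong (suc ∘ length) (sym (filter-filter (Small? (suc i)) (InE? (suc i)) (allFin k))) ⟩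
    suc (s (suc i))                            ∎
    where
    open ℕₚ.≤-Reasoning
    Sᵢ? : Decidable (λ e → InE i e × w i e ℚ.≤ ⟦ 2 ⟧)
    Sᵢ? = InE? i ∩? Small? i
    Sᵢ₊₁? : Decidable (λ e → InE (suc i) e × w (suc i) e ℚ.≤ ⟦ 2 ⟧)
    Sᵢ₊₁? = InE? (suc i) ∩? Small? (suc i)
    stays : ∀ e → InE i e × w i e ℚ.≤ ⟦ 2 ⟧ → e ≢ eᵢ₊₁ i<k → InE (suc i) e × w (suc i) e ℚ.≤ ⟦ 2 ⟧
    stays e (inE , small) e≢eᵢ₊₁ = inE′ , ℚₚ.≤-trans (proj₂ (reweight i i<k e inE′)) small
      where
      inE′ : InE (suc i) e
      inE′ = InE⇒InE-suc i<k inE (e≢eᵢ₊₁ ∘ sym)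

  b-step : ∀ i → i ℕ.< k → b (suc i) ℚ.≤ b i
  b-step i i<k = begin
    b (suc i)                                  ≡⟨ cong (sumL (w (suc i))) (filter-filter (Big? (suc i)) (InE? (suc i)) (allFin k)) ⟩
    sumL (w (suc i)) (filter Bᵢ₊₁? (allFin k)) ≤⟨ sumL-filter-mono Bᵢ₊₁? Bᵢ? stays lighter nonneg (allFin k) ⟩
    sumL (w i) (filter Bᵢ? (allFin k))         ≡⟨ cong (sumL (w i)) (sym (filter-filter (Big? i) (InE? i) (allFin k))) ⟩
    b i                                        ∎
    where
    open ℚₚ.≤-Reasoning
    Bᵢ? : Decidable (λ e → InE i e × ⟦ 80 ⟧ ℚ.≤ w i e)
    Bᵢ? = InE? i ∩? Big? i
    Bᵢ₊₁? : Decidable (λ e → InE (suc i) e × ⟦ 80 ⟧ ℚ.≤ w (suc i) e)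
    Bᵢ₊₁? = InE? (suc i) ∩? Big? (suc i)
    lighter : ∀ e → InE (suc i) e × ⟦ 80 ⟧ ℚ.≤ w (suc i) e → w (suc i) e ℚ.≤ w i e
    lighter e (inE , _) = proj₂ (reweight i i<k e inE)
    stays : ∀ e → InE (suc i) e × ⟦ 80 ⟧ ℚ.≤ w (suc i) e → InE i e × ⟦ 80 ⟧ ℚ.≤ w i e
    stays e big@(inE , 80≤w) = InE-suc⇒InE inE , ℚₚ.≤-trans 80≤w (lighter e big)
    nonneg : ∀ e → InE i e × ⟦ 80 ⟧ ℚ.≤ w i e → 0ℚ ℚ.≤ w i e
    nonneg e (_ , 80≤w) = ℚₚ.≤-trans (0≤⟦⟧ 80) 80≤w

  b-antitone : ∀ {i j} → i ℕ.≤ j → j ℕ.≤ k → b j ℚ.≤ b i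
  b-antitone = antitone-from-step b b-step

  b₀≤k : b 0 ℚ.≤ ⟦ k ⟧
  b₀≤k = begin
    b 0                                          ≡⟨ cong (sumL (w 0)) (filter-filter (Big? 0) (InE? 0) (allFin k)) ⟩
    sumL (w 0) (filter (InE? 0 ∩? Big? 0) (allFin k))
                                                 ≤⟨ sumL-filter-mono (InE? 0 ∩? Big? 0) (InE? 0) (λ _ → proj₁)
                                                      (λ _ _ → ℚₚ.≤-refl) (λ e _ → w₀-nonneg e) (allFin k) ⟩
    W 0                                          ≡⟨ normalised ⟩
    ⟦ k ⟧                                        ∎
    where open ℚₚ.≤-Reasoning

  W≤80|E|+b : ∀ i → W i ℚ.≤ ⟦ 80 ℕ.* length (E i) ⟧ ℚ.+ b i
  W≤80|E|+b i = begin
    W i                                               ≤⟨ sumL-≤-const+filter (Big? i) (w i) (0≤⟦⟧ 80) (λ _ → ℚₚ.<⇒≤ ∘ ℚₚ.≰⇒>) (E i) ⟩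
    sumL (λ _ → ⟦ 80 ⟧) (E i) ℚ.+ b i                 ≡⟨ cong (ℚ._+ b i) (sumL-const 80 (E i)) ⟩
    ⟦ 80 ℕ.* length (E i) ⟧ ℚ.+ b i                   ∎
    where open ℚₚ.≤-Reasoning

  k≤2s₀ : k ℕ.≤ 2 ℕ.* s 0
  k≤2s₀ = ℕₚ.+-cancelˡ-≤ k k (2 ℕ.* s 0) (⟦⟧-cancel-≤ (begin
    ⟦ k ℕ.+ k ⟧                                       ≡⟨ cong (λ n → ⟦ k ℕ.+ n ⟧) (sym (ℕₚ.+-identityʳ k)) ⟩
    ⟦ 2 ℕ.* k ⟧                                       ≡⟨ cong (λ n → ⟦ 2 ℕ.* n ⟧) (sym length-E₀) ⟩
    ⟦ 2 ℕ.* length (E 0) ⟧                            ≡⟨ sym (sumL-const 2 (E 0)) ⟩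
    sumL (λ _ → ⟦ 2 ⟧) (E 0)                          ≤⟨ const≤sumL+filter (Small? 0) (w 0) w₀-nonneg (λ _ → ℚₚ.<⇒≤ ∘ ℚₚ.≰⇒>) (E 0) ⟩
    W 0 ℚ.+ sumL (λ _ → ⟦ 2 ⟧) (S 0)                  ≡⟨ cong₂ ℚ._+_ normalised (sumL-const 2 (S 0)) ⟩
    ⟦ k ⟧ ℚ.+ ⟦ 2 ℕ.* s 0 ⟧                           ≡⟨ sym (⟦⟧-+ k _) ⟩
    ⟦ k ℕ.+ 2 ℕ.* s 0 ⟧                               ∎))
    where open ℚₚ.≤-Reasoning

  record FirstAtMost (ℓ t : ℕ) : Set where
    field
      t≤k    : t ℕ.≤ k
      sₜ≤ℓ   : s t ℕ.≤ ℓ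
      before : ∀ j → j ℕ.< t → ℓ ℕ.< s j
  open FirstAtMost

  firstAtMost : ∀ ℓ → ∃ (FirstAtMost ℓ)
  firstAtMost ℓ =
    let t , sₜ≮ℓ , earlier = Finₚ.¬∀⟶∃¬-smallest (suc k) (λ j → ℓ ℕ.< s (toℕ j)) (λ j → ℓ ℕₚ.<? s (toℕ j)) ℓ≮sₖ
    in toℕ t , record
      { t≤k    = Finₚ.toℕ≤pred[n] t
      ; sₜ≤ℓ   = ℕₚ.≮⇒≥ sₜ≮ℓ
      ; before = λ j j<t → subst (λ n → ℓ ℕ.< s n) (trans (Finₚ.toℕ-inject _) (Finₚ.toℕ-fromℕ< j<t))
                                 (earlier (fromℕ< j<t))
      }
    where
    ℓ≮sₖ : ¬ (∀ j → ℓ ℕ.< s (toℕ j))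
    ℓ≮sₖ ℓ<s = ℕₚ.n≮0 (ℕₚ.<-≤-trans (subst (λ n → ℓ ℕ.< s n) (Finₚ.toℕ-fromℕ k) (ℓ<s (Fin.fromℕ k)))
                                    (ℕₚ.≤-trans (s≤k∸i ℕₚ.≤-refl) (ℕₚ.≤-reflexive (ℕₚ.n∸n≡0 k))))

  FirstAtMost⇒IsFirst : ∀ {ℓ t} → ℓ ℕ.≤ s 0 → FirstAtMost ℓ t → IsFirst ℓ t
  FirstAtMost⇒IsFirst {ℓ} {t} ℓ≤s₀ first =
    t≤k first , ℕₚ.≤-antisym (sₜ≤ℓ first) (ℓ≤sₜ t (t≤k first) (before first)) ,
    λ j j<t sⱼ≡ℓ → ℕₚ.<-irrefl (sym sⱼ≡ℓ) (before first j j<t)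
    where
    ℓ≤sₜ : ∀ t → t ℕ.≤ k → (∀ j → j ℕ.< t → ℓ ℕ.< s j) → ℓ ℕ.≤ s t
    ℓ≤sₜ zero    _   _      = ℓ≤s₀
    ℓ≤sₜ (suc j) j<k before = ℕₚ.≤-pred (ℕₚ.≤-trans (before j ℕₚ.≤-refl) (s-step j<k))

  FirstAtMost-least : ∀ {ℓ t i} → FirstAtMost ℓ t → s i ℕ.≤ ℓ → t ℕ.≤ i
  FirstAtMost-least {i = i} first sᵢ≤ℓ = ℕₚ.≮⇒≥ λ i<t → ℕₚ.<⇒≱ (before first i i<t) sᵢ≤ℓ

  IsLmax⇒1≤L : ∀ {L} → IsLmax L → 1 ℕ.≤ L
  IsLmax⇒1≤L (inj₁ (bad , _)) = proj₁ bad
  IsLmax⇒1≤L (inj₂ (refl , _)) = ℕₚ.≤-refl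

  IsLmax⇒Bad⇒≤L : ∀ {L ℓ} → IsLmax L → Bad ℓ → ℓ ℕ.≤ L
  IsLmax⇒Bad⇒≤L (inj₁ (_ , maximal)) bad = maximal _ bad
  IsLmax⇒Bad⇒≤L (inj₂ (_ , none))    bad = contradiction bad (none _)

  b-bound : ∀ {L} → IsLmax L → ∀ m → L ℕ.< m → ∀ {i} → i ℕ.≤ k → s i ℕ.≤ m → b i ℚ.≤ ⟦ 4 ℕ.* m ⟧
  b-bound {L} isLmax = doubling-induction G L (s 0) large double
    where
    G : ℕ → Set
    G m = ∀ {i} → i ℕ.≤ k → s i ℕ.≤ m → b i ℚ.≤ ⟦ 4 ℕ.* m ⟧

    large : ∀ m → s 0 ℕ.< 2 ℕ.* m → G m
    large m s₀<2m {i} i≤k _ = begin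
      b i                 ≤⟨ b-antitone z≤n i≤k ⟩
      b 0                 ≤⟨ b₀≤k ⟩
      ⟦ k ⟧               ≤⟨ ⟦⟧-mono-≤ (ℕₚ.≤-trans k≤2s₀ (ℕₚ.*-monoʳ-≤ 2 (ℕₚ.<⇒≤ s₀<2m))) ⟩
      ⟦ 2 ℕ.* (2 ℕ.* m) ⟧ ≡⟨ cong ⟦_⟧ (sym (ℕₚ.*-assoc 2 2 m)) ⟩
      ⟦ 4 ℕ.* m ⟧         ∎
      where open ℚₚ.≤-Reasoning

    double : ∀ m → L ℕ.< m → 2 ℕ.* m ℕ.≤ s 0 → G (2 ℕ.* m) → G m
    double m L<m 2m≤s₀ G₂ₘ {i} i≤k sᵢ≤m with firstAtMost m | firstAtMost (2 ℕ.* m)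
    ... | t , first | t₂ , first₂ = ℚₚ.≤-trans (b-antitone (FirstAtMost-least first sᵢ≤m) i≤k) bₜ≤4m
      where
      m≤s₀/2 : m ℕ.≤ s 0 / 2
      m≤s₀/2 = subst (ℕ._≤ s 0 / 2) (DivMod.m*n/n≡m m 2) (DivMod./-monoˡ-≤ 2 (subst (ℕ._≤ s 0) (ℕₚ.*-comm 2 m) 2m≤s₀))

      bₜ≤4m : b t ℚ.≤ ⟦ 4 ℕ.* m ⟧
      bₜ≤4m with b t ℚₚ.≤? ⟦ 4 ℕ.* m ⟧
      ... | yes bₜ≤4m = bₜ≤4m
      ... | no  bₜ≰4m = contradiction (IsLmax⇒Bad⇒≤L isLmax m-bad) (ℕₚ.<⇒≱ L<m)
        where
        m-bad : Bad m
        m-bad = ℕₚ.≤-trans (s≤s z≤n) L<m , m≤s₀/2 , t , t₂ ,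
                FirstAtMost⇒IsFirst (ℕₚ.≤-trans (ℕₚ.m≤m+n m _) 2m≤s₀) first ,
                FirstAtMost⇒IsFirst 2m≤s₀ first₂ ,
                subst (λ n → b t₂ ℚ.≤ ⟦ n ⟧) (sym (ℕₚ.*-assoc 4 2 m)) (G₂ₘ (t≤k first₂) (sₜ≤ℓ first₂)) ,
                ℚₚ.≰⇒> bₜ≰4m

80m+4[1+L⊔s]≤90Lm : ∀ {L m s} → 1 ℕ.≤ L → 1 ℕ.≤ m → s ℕ.≤ m → 80 ℕ.* m ℕ.+ 4 ℕ.* (suc L ℕ.⊔ s) ℕ.≤ 90 ℕ.* L ℕ.* m
80m+4[1+L⊔s]≤90Lm {suc L} {suc m} {s} _ _ s≤1+m = begin
  80 ℕ.* M ℕ.+ 4 ℕ.* (suc (suc L) ℕ.⊔ s)        ≤⟨ ℕₚ.+-monoʳ-≤ (80 ℕ.* M) (ℕₚ.*-monoʳ-≤ 4 ℓ≤2LM) ⟩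
  80 ℕ.* M ℕ.+ 4 ℕ.* (2 ℕ.* suc L ℕ.* M)         ≤⟨ ℕₚ.m≤m+n _ (80 ℕ.* L ℕ.* M ℕ.+ 2 ℕ.* suc L ℕ.* M) ⟩
  80 ℕ.* M ℕ.+ 4 ℕ.* (2 ℕ.* suc L ℕ.* M) ℕ.+ (80 ℕ.* L ℕ.* M ℕ.+ 2 ℕ.* suc L ℕ.* M)
                                                 ≡⟨ solve 2 (λ L M → con 80 :* M :+ con 4 :* (con 2 :* (con 1 :+ L) :* M)
                                                                      :+ (con 80 :* L :* M :+ con 2 :* (con 1 :+ L) :* M)
                                                                    := con 90 :* (con 1 :+ L) :* M) refl L M ⟩
  90 ℕ.* suc L ℕ.* M                             ∎
  where
  open ℕₚ.≤-Reasoning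
  open ℕSolver.+-*-Solver
  M : ℕ
  M = suc m
  ℓ≤2LM : suc (suc L) ℕ.⊔ s ℕ.≤ 2 ℕ.* suc L ℕ.* M
  ℓ≤2LM = ℕₚ.⊔-lub (ℕₚ.≤-trans (ℕₚ.m<m+n (suc L) z<s) (ℕₚ.m≤m*n (2 ℕ.* suc L) M))
                   (ℕₚ.≤-trans s≤1+m (ℕₚ.m≤n*m M (2 ℕ.* suc L)))

lemma8 : (ε : ℚ) → 0ℚ ℚ.< ε → ε ℚ.< ½ →
         (k : ℕ) (σ : Fin k → Fin k) (w : ℕ → Fin k → ℚ) (p : ℕ → Fin k → ℚ) →
         Process.ValidRun k σ w ε p →
         (L : ℕ) → Process.IsLmax k σ w L →
         ∀ i → i ℕ.< k → Process.W k σ w i ℚ.≤ ⟦ 90 ℕ.* L ⟧ ℚ.* ⟦ k ∸ i ⟧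
lemma8 _ _ _ k σ w _ run L isLmax i i<k = begin
  W i                                         ≤⟨ W≤80|E|+b i ⟩
  ⟦ 80 ℕ.* length (E i) ⟧ ℚ.+ b i             ≤⟨ ℚₚ.+-mono-≤ (⟦⟧-mono-≤ (ℕₚ.*-monoʳ-≤ 80 (length-E i≤k)))
                                                              (b-bound isLmax ℓ (ℕₚ.m≤m⊔n (suc L) (s i)) i≤k (ℕₚ.m≤n⊔m (suc L) (s i))) ⟩
  ⟦ 80 ℕ.* (k ∸ i) ⟧ ℚ.+ ⟦ 4 ℕ.* ℓ ⟧          ≡⟨ sym (⟦⟧-+ (80 ℕ.* (k ∸ i)) (4 ℕ.* ℓ)) ⟩
  ⟦ 80 ℕ.* (k ∸ i) ℕ.+ 4 ℕ.* ℓ ⟧              ≤⟨ ⟦⟧-mono-≤ (80m+4[1+L⊔s]≤90Lm (IsLmax⇒1≤L isLmax) (ℕₚ.m<n⇒0<n∸m i<k) (s≤k∸i i≤k)) ⟩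
  ⟦ 90 ℕ.* L ℕ.* (k ∸ i) ⟧                    ≡⟨ ⟦⟧-* (90 ℕ.* L) (k ∸ i) ⟩
  ⟦ 90 ℕ.* L ⟧ ℚ.* ⟦ k ∸ i ⟧                  ∎
  where
  open Process k σ w
  open Run run
  open ℚₚ.≤-Reasoning
  i≤k : i ℕ.≤ k
  i≤k = ℕₚ.<⇒≤ i<k
  ℓ : ℕ
  ℓ = suc L ℕ.⊔ s i
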